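{- Let $(x_1,y_1),\dots,(x_m,y_m)$ be a stream with $x_i\in[N]$ and $y_i\in\{0,1,\dots,M\}$, $M\ge1$, and let $\epsilon\in(0,1)$ and $\beta=\epsilon/(32M^2)$. For an interval $R\subseteq[N]$ let $n_R=\sum_i\mathbf{1}[x_i\in R]$, $s_R=\sum_i\mathbf{1}[x_i\in R]y_i$, $q_R=\sum_i\mathbf{1}[x_i\in R]y_i^2$, and $\mathrm{SSE}(R)=q_R-s_R^2/n_R$ if $n_R>0$ and $\mathrm{SSE}(R)=0$ if $n_R=0$. Suppose that for every interval $R\subseteq[N]$ we are given estimates $\widehat n_R=n_R+a_R$, $\widehat s_R=s_R+b_R$, $\widehat q_R=q_R+c_R$ with $0\le a_R\le\beta m$, $0\le b_R\le\beta Mm$, $0\le c_R\le \beta M^2m$. Define $\widehat{\mathrm{SSE}}(R)=\widehat q_R-\widehat s_R^2/(\widehat n_R+\beta m)$ if $\widehat n_R>0$ and $\widehat{\mathrm{SSE}}(R)=0$ if $\widehat n_R=0$, and for a split $j$ define $\widehat L(j)=\frac1m\bigl(\widehat{\mathrm{SSE}}([1,j])+\widehat{\mathrm{SSE}}([j+1,N])\bigr)$ and $L(j)=\frac1m\bigl(\mathrm{SSE}([1,j])+\mathrm{SSE}([j+1,N])\bigr)$. Then for every candidate split $j\in S$, $|\widehat L(j)-L(j)|\le \epsilon/4$.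
   Context: Here $S\subseteq\{0,1,\dots,N\}$ is the algorithm's set of candidate splits: $S=\{0,N\}\cup\{x,\,x-1: (x,y)\text{ appears in a reservoir sample of the stream and }x>1\}$. $L(j)$ equals the mean squared regression loss of split $j$, i.e. the average over the stream of the squared deviation of each label from the mean label on its side ($[1,j]$ or $[j+1,N]$); the interval $[1,0]$ is empty.
   Formalization: The accuracy parameter $\epsilon$ and the estimates $\widehat n_R$, $\widehat s_R$, $\widehat q_R$ take rational values. -}

module Defs where

open import Data.Bool using (Bool; true; false; if_then_else_; _∧_)
open import Data.Nat as ℕ using (ℕ; zero; suc)
open import Data.Integer using (+_)
open import Data.Rational using (ℚ; 0ℚ; _+_; _*_; _-_; _÷_; _/_; _≤ᵇ_)
open import Data.Rational.Properties using (_≟_)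
open import Data.Product using (_×_; _,_; proj₁; proj₂)
open import Data.Sum using (_⊎_)
open import Data.List using (List; []; _∷_; length)
open import Data.List.Membership.Propositional using (_∈_)
open import Relation.Nullary using (yes; no)
open import Relation.Binary.PropositionalEquality using (_≡_)

⟦_⟧ : ℕ → ℚ
⟦ n ⟧ = + n / 1

-- total division on ℚ; convention p ÷? 0 = 0.  It is only ever applied
-- where the paper's divisor is nonzero.
_÷?_ : ℚ → ℚ → ℚ
p ÷? q with q ≟ 0ℚ
... | yes _ = 0ℚ
... | no q≢0 = _÷_ p q {{Data.Rational.≢-nonZero q≢0}}

Stream : Set
Stream = List (ℕ × ℕ)

inI : ℕ → ℕ → ℕ → Bool
inI l r x = (l ℕ.≤ᵇ x) ∧ (x ℕ.≤ᵇ r)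

nR : Stream → ℕ → ℕ → ℚ
nR [] l r = 0ℚ
nR ((x , y) ∷ st) l r = (if inI l r x then ⟦ 1 ⟧ else 0ℚ) + nR st l r

sR : Stream → ℕ → ℕ → ℚ
sR [] l r = 0ℚ
sR ((x , y) ∷ st) l r = (if inI l r x then ⟦ y ⟧ else 0ℚ) + sR st l r

qR : Stream → ℕ → ℕ → ℚ
qR [] l r = 0ℚ
qR ((x , y) ∷ st) l r = (if inI l r x then ⟦ y ⟧ * ⟦ y ⟧ else 0ℚ) + qR st l r

SSE : Stream → ℕ → ℕ → ℚ
SSE st l r =
  if nR st l r ≤ᵇ 0ℚ then 0ℚ
  else (qR st l r - ((sR st l r * sR st l r) ÷? nR st l r))

-- estimated SSE from estimates n̂, ŝ, q̂ of an interval and the value βm: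
-- q̂ - ŝ^2/(n̂ + βm) if n̂ > 0, and 0 otherwise (n̂ ≥ 0 under the hypotheses)
SSEhat : (βm nh sh qh : ℚ) → ℚ
SSEhat βm nh sh qh =
  if nh ≤ᵇ 0ℚ then 0ℚ else (qh - ((sh * sh) ÷? (nh + βm)))

L : Stream → (N j : ℕ) → ℚ
L st N j = (SSE st 1 j + SSE st (suc j) N) ÷? ⟦ length st ⟧

Lhat : Stream → (N : ℕ) → (β : ℚ) → (nh sh qh : ℕ → ℕ → ℚ) → (j : ℕ) → ℚ
Lhat st N β nh sh qh j =
  (SSEhat βm (nh 1 j) (sh 1 j) (qh 1 j)
   + SSEhat βm (nh (suc j) N) (sh (suc j) N) (qh (suc j) N)) ÷? m
  where
    m = ⟦ length st ⟧
    βm = β * m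

InS : (N : ℕ) → (sample : List (ℕ × ℕ)) → ℕ → Set
InS N sample j =
  (j ≡ 0) ⊎ (j ≡ N) ⊎
  Data.Product.Σ (ℕ × ℕ) (λ p → (p ∈ sample) × (1 ℕ.< proj₁ p) × ((j ≡ proj₁ p) ⊎ (j ≡ proj₁ p ℕ.∸ 1)))

-- Put a = βm and E = M²a.  On every interval q̂ exceeds q by at most E, and the
-- estimated ratio ŝ²/(n̂ + a) stays within [s²/n − 2E, s²/n + E]: from above since
-- ŝ ≤ s + Ma, n̂ ≥ n and Sedrakyan's inequality give (s + Ma)²/(n + a) ≤ s²/n + (Ma)²/a;
-- from below since ŝ ≥ s, n̂ + a ≤ n + 2a, and enlarging the denominator n by 2a lowers
-- s²/n by at most (s/n)²·2a ≤ 2E, as s ≤ Mn.  So each estimated SSE is within 3E of the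
-- true one, and the two sides of a split give |L̂(j) − L(j)| ≤ 6E/m = 6ε/32 ≤ ε/4.
{-# OPTIONS --safe #-}
module Submission where

open import Defs
open import Data.Nat as ℕ using (ℕ; suc)
open import Data.Integer using (+_)
open import Data.Rational using (ℚ; 0ℚ; 1ℚ; _+_; _*_; _-_; _/_; _≤_; _<_; ∣_∣)
open import Data.Product using (_×_; _,_)
open import Data.List using (List; length)
open import Data.List.Relation.Unary.All using (All)
open import Data.List.Membership.Propositional using (_∈_)

open import Data.Bool using (true; false; T; if_then_else_)
open import Data.Empty using (⊥-elim)
open import Data.List using ([]; _∷_)
import Data.List.Relation.Unary.All as All
import Data.Nat.Coprimality as Coprimality
import Data.Nat.Properties as ℕₚ
import Data.Integer as ℤ
import Data.Integer.Properties as ℤₚ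
open import Data.Product using (proj₁; proj₂)
open import Data.Rational using (-_; 1/_; mkℚ; _≤ᵇ_; *≤*; NonZero; ≢-nonZero; positive; nonNegative; nonPositive)
import Data.Rational.Properties as ℚₚ
open import Data.Rational.Properties using (≤-refl; ≤-reflexive; ≤-trans; <⇒≤; +-mono-≤; +-monoˡ-≤; module ≤-Reasoning)
open import Data.Sum using (_⊎_; inj₁; inj₂)
open import Function using (_∘_)
open import Level using (0ℓ)
open import Relation.Binary.Definitions using (tri<; tri≈; tri>)
open import Relation.Binary.PropositionalEquality
open import Relation.Nullary using (yes; no; dec⇒maybe)
open import Tactic.RingSolver using (solve-∀; solve)
import Tactic.RingSolver.Core.AlmostCommutativeRing as ACR

-- The solver needs a real zero test: without it cancelled coefficients are kept and
-- normal forms of equal polynomials fail to match.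
ℚ-ring : ACR.AlmostCommutativeRing 0ℓ 0ℓ
ℚ-ring = ACR.fromCommutativeRing ℚₚ.+-*-commutativeRing (λ p → dec⇒maybe (0ℚ ℚₚ.≟ p))

0≤p+q : ∀ {p q} → 0ℚ ≤ p → 0ℚ ≤ q → 0ℚ ≤ p + q
0≤p+q = +-mono-≤

0<p+q : ∀ {p q} → 0ℚ ≤ p → 0ℚ < q → 0ℚ < p + q
0<p+q = ℚₚ.+-mono-≤-<

0≤p*q : ∀ {p q} → 0ℚ ≤ p → 0ℚ ≤ q → 0ℚ ≤ p * q
0≤p*q {p} {q} 0≤p 0≤q = ℚₚ.nonNegative⁻¹ _
  {{ℚₚ.nonNeg*nonNeg⇒nonNeg p {{nonNegative 0≤p}} q {{nonNegative 0≤q}}}}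

0<p*q : ∀ {p q} → 0ℚ < p → 0ℚ < q → 0ℚ < p * q
0<p*q {p} {q} 0<p 0<q = ℚₚ.positive⁻¹ _
  {{ℚₚ.pos*pos⇒pos p {{positive 0<p}} q {{positive 0<q}}}}

0≤p*p : ∀ p → 0ℚ ≤ p * p
0≤p*p p with ℚₚ.≤-total 0ℚ p
... | inj₁ 0≤p = 0≤p*q 0≤p 0≤p
... | inj₂ p≤0 = ℚₚ.nonNegative⁻¹ _
  {{ℚₚ.nonPos*nonPos⇒nonPos p {{nonPositive p≤0}} p {{nonPositive p≤0}}}}

0≤p⇒0<p⊎p≡0 : ∀ {p} → 0ℚ ≤ p → 0ℚ < p ⊎ p ≡ 0ℚ
0≤p⇒0<p⊎p≡0 {p} 0≤p with ℚₚ.<-cmp 0ℚ p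
... | tri< 0<p _ _ = inj₁ 0<p
... | tri≈ _ 0≡p _ = inj₂ (sym 0≡p)
... | tri> _ _ p<0 = ⊥-elim (ℚₚ.<-irrefl refl (ℚₚ.<-≤-trans p<0 0≤p))

p≤q⇒0≤q-p : ∀ {p q} → p ≤ q → 0ℚ ≤ q - p
p≤q⇒0≤q-p {p} {q} p≤q = subst (_≤ q - p) (ℚₚ.+-inverseʳ p) (+-monoˡ-≤ (- p) p≤q)

0≤q-p⇒p≤q : ∀ {p q} → 0ℚ ≤ q - p → p ≤ q
0≤q-p⇒p≤q {p} {q} 0≤q-p = subst₂ _≤_ (ℚₚ.+-identityʳ p) p+[q-p]≡q (ℚₚ.+-monoʳ-≤ p 0≤q-p)
  where
  p+[q-p]≡q : p + (q - p) ≡ q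
  p+[q-p]≡q = solve (p ∷ q ∷ []) ℚ-ring

≤-by-difference : ∀ {p q} d → q - p ≡ d → 0ℚ ≤ d → p ≤ q
≤-by-difference d q-p≡d 0≤d = 0≤q-p⇒p≤q (subst (0ℚ ≤_) (sym q-p≡d) 0≤d)

≤-by-scaled-difference : ∀ {p q c} d → 0ℚ < c → (q - p) * c ≡ d → 0ℚ ≤ d → p ≤ q
≤-by-scaled-difference {p} {q} {c} d 0<c [q-p]*c≡d 0≤d = 0≤q-p⇒p≤q
  (ℚₚ.*-cancelʳ-≤-pos c {{positive 0<c}}
    (subst₂ _≤_ (sym (ℚₚ.*-zeroˡ c)) (sym [q-p]*c≡d) 0≤d))

p*p≤q*q : ∀ {p q} → 0ℚ ≤ p → p ≤ q → p * p ≤ q * q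
p*p≤q*q {p} {q} 0≤p p≤q = ≤-by-difference ((q - p) * (q + p)) (solve (p ∷ q ∷ []) ℚ-ring)
  (0≤p*q (p≤q⇒0≤q-p p≤q) (0≤p+q (≤-trans 0≤p p≤q) 0≤p))

-p≤q⇒p≤q⇒∣p∣≤q : ∀ {p q} → - p ≤ q → p ≤ q → ∣ p ∣ ≤ q
-p≤q⇒p≤q⇒∣p∣≤q {p} {q} -p≤q p≤q with ℚₚ.∣p∣≡p∨∣p∣≡-p p
... | inj₁ ∣p∣≡p = subst (_≤ q) (sym ∣p∣≡p) p≤q
... | inj₂ ∣p∣≡-p = subst (_≤ q) (sym ∣p∣≡-p) -p≤q

∣[p+q]-[r+s]∣≤∣p-r∣+∣q-s∣ : ∀ p q r s → ∣ (p + q) - (r + s) ∣ ≤ ∣ p - r ∣ + ∣ q - s ∣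
∣[p+q]-[r+s]∣≤∣p-r∣+∣q-s∣ p q r s =
  subst (λ t → ∣ t ∣ ≤ ∣ p - r ∣ + ∣ q - s ∣) regroup (ℚₚ.∣p+q∣≤∣p∣+∣q∣ (p - r) (q - s))
  where
  regroup : (p - r) + (q - s) ≡ (p + q) - (r + s)
  regroup = solve (p ∷ q ∷ r ∷ s ∷ []) ℚ-ring

÷?-inverse : ∀ p {q} → 0ℚ < q → (p ÷? q) * q ≡ p
÷?-inverse p {q} 0<q with q ℚₚ.≟ 0ℚ
... | yes q≡0 = ⊥-elim (ℚₚ.<-irrefl (sym q≡0) 0<q)
... | no q≢0 = begin
  p * 1/ q * q   ≡⟨ ℚₚ.*-assoc p (1/ q) q ⟩
  p * (1/ q * q) ≡⟨ cong (p *_) (ℚₚ.*-inverseˡ q) ⟩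
  p * 1ℚ         ≡⟨ ℚₚ.*-identityʳ p ⟩
  p              ∎
  where
  open ≡-Reasoning
  instance
    q-nonZero : NonZero q
    q-nonZero = ≢-nonZero q≢0

p≤r*q⇒p÷?q≤r : ∀ {p q r} → 0ℚ < q → p ≤ r * q → p ÷? q ≤ r
p≤r*q⇒p÷?q≤r {p} {q} 0<q p≤r*q = ℚₚ.*-cancelʳ-≤-pos q {{positive 0<q}}
  (subst (_≤ _) (sym (÷?-inverse p 0<q)) p≤r*q)

r*q≤p⇒r≤p÷?q : ∀ {p q r} → 0ℚ < q → r * q ≤ p → r ≤ p ÷? q
r*q≤p⇒r≤p÷?q {p} {q} 0<q r*q≤p = ℚₚ.*-cancelʳ-≤-pos q {{positive 0<q}}
  (subst (_ ≤_) (sym (÷?-inverse p 0<q)) r*q≤p)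

[r*q]÷?q≡r : ∀ r {q} → 0ℚ < q → (r * q) ÷? q ≡ r
[r*q]÷?q≡r r 0<q = ℚₚ.≤-antisym (p≤r*q⇒p÷?q≤r 0<q ≤-refl) (r*q≤p⇒r≤p÷?q 0<q ≤-refl)

÷?-nonNeg : ∀ {p q} → 0ℚ ≤ p → 0ℚ < q → 0ℚ ≤ p ÷? q
÷?-nonNeg {p} {q} 0≤p 0<q = r*q≤p⇒r≤p÷?q 0<q (subst (_≤ p) (sym (ℚₚ.*-zeroˡ q)) 0≤p)

÷?-pos : ∀ {p q} → 0ℚ < p → 0ℚ < q → 0ℚ < p ÷? q
÷?-pos {p} {q} 0<p 0<q = ℚₚ.*-cancelʳ-<-nonNeg q {{nonNegative (<⇒≤ 0<q)}}
  (subst₂ _<_ (sym (ℚₚ.*-zeroˡ q)) (sym (÷?-inverse p 0<q)) 0<p)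

÷?-mono-≤ : ∀ {p p′ q q′} → 0ℚ ≤ p → p ≤ p′ → 0ℚ < q′ → q′ ≤ q → p ÷? q ≤ p′ ÷? q′
÷?-mono-≤ {p} {p′} {q} {q′} 0≤p p≤p′ 0<q′ q′≤q = r*q≤p⇒r≤p÷?q 0<q′ (begin
  (p ÷? q) * q′ ≤⟨ ℚₚ.*-monoˡ-≤-nonNeg (p ÷? q) {{nonNegative (÷?-nonNeg 0≤p 0<q)}} q′≤q ⟩
  (p ÷? q) * q  ≡⟨ ÷?-inverse p 0<q ⟩
  p             ≤⟨ p≤p′ ⟩
  p′            ∎)
  where
  open ≤-Reasoning
  0<q = ℚₚ.<-≤-trans 0<q′ q′≤q

∣p÷?r-q÷?r∣≤e : ∀ {p q r e} → 0ℚ < r → ∣ p - q ∣ ≤ e * r → ∣ p ÷? r - q ÷? r ∣ ≤ e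
∣p÷?r-q÷?r∣≤e {p} {q} {r} {e} 0<r ∣p-q∣≤e*r = ℚₚ.*-cancelʳ-≤-pos r {{positive 0<r}} (begin
  ∣ p′ - q′ ∣ * r       ≡⟨ cong (∣ p′ - q′ ∣ *_) (sym (ℚₚ.0≤p⇒∣p∣≡p (<⇒≤ 0<r))) ⟩
  ∣ p′ - q′ ∣ * ∣ r ∣   ≡⟨ sym (ℚₚ.∣p*q∣≡∣p∣*∣q∣ (p′ - q′) r) ⟩
  ∣ (p′ - q′) * r ∣     ≡⟨ cong ∣_∣ (distribʳ p′ q′ r) ⟩
  ∣ p′ * r - q′ * r ∣   ≡⟨ cong₂ (λ x y → ∣ x - y ∣) (÷?-inverse p 0<r) (÷?-inverse q 0<r) ⟩
  ∣ p - q ∣             ≤⟨ ∣p-q∣≤e*r ⟩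
  e * r                 ∎)
  where
  open ≤-Reasoning
  p′ = p ÷? r
  q′ = q ÷? r
  distribʳ : ∀ x y z → (x - y) * z ≡ x * z - y * z
  distribʳ = solve-∀ ℚ-ring

⟦n⟧≡mkℚ : ∀ n → ⟦ n ⟧ ≡ mkℚ (+ n) 0 (Coprimality.sym (Coprimality.1-coprimeTo n))
⟦n⟧≡mkℚ n = ℚₚ.normalize-coprime (Coprimality.sym (Coprimality.1-coprimeTo n))

⟦⟧-homo-* : ∀ m n → ⟦ m ℕ.* n ⟧ ≡ ⟦ m ⟧ * ⟦ n ⟧
⟦⟧-homo-* m n = trans (cong (_/ 1) (ℤₚ.pos-* m n)) (sym (cong₂ _*_ (⟦n⟧≡mkℚ m) (⟦n⟧≡mkℚ n)))

⟦⟧-mono-≤ : ∀ {m n} → m ℕ.≤ n → ⟦ m ⟧ ≤ ⟦ n ⟧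
⟦⟧-mono-≤ {m} {n} m≤n = subst₂ _≤_ (sym (⟦n⟧≡mkℚ m)) (sym (⟦n⟧≡mkℚ n))
  (*≤* (subst₂ ℤ._≤_ (sym (ℤₚ.*-identityʳ (+ m))) (sym (ℤₚ.*-identityʳ (+ n))) (ℤ.+≤+ m≤n)))

0≤⟦n⟧ : ∀ n → 0ℚ ≤ ⟦ n ⟧
0≤⟦n⟧ n = ⟦⟧-mono-≤ {0} {n} ℕ.z≤n

0<⟦n⟧ : ∀ {n} → 1 ℕ.≤ n → 0ℚ < ⟦ n ⟧
0<⟦n⟧ {suc n} _ = ℚₚ.positive⁻¹ _ {{ℚₚ.normalize-pos (suc n) 1}}

sedrakyan : ∀ x y {u v} → 0ℚ < u → 0ℚ < v
          → ((x + y) * (x + y)) ÷? (u + v) ≤ (x * x) ÷? u + (y * y) ÷? v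
sedrakyan x y {u} {v} 0<u 0<v = p≤r*q⇒p÷?q≤r (0<p+q (<⇒≤ 0<u) 0<v)
  (≤-by-scaled-difference ((x * v - y * u) * (x * v - y * u)) (0<p*q 0<u 0<v) cleared (0≤p*p (x * v - y * u)))
  where
  a = (x * x) ÷? u
  b = (y * y) ÷? v
  expand : ∀ a b x y u v → ((a + b) * (u + v) - (x + y) * (x + y)) * (u * v)
         ≡ a * u * (u * v + v * v) + b * v * (u * u + u * v) - (x + y) * (x + y) * (u * v)
  expand = solve-∀ ℚ-ring
  complete-square : ∀ x y u v → x * x * (u * v + v * v) + y * y * (u * u + u * v) - (x + y) * (x + y) * (u * v)
                  ≡ (x * v - y * u) * (x * v - y * u)
  complete-square = solve-∀ ℚ-ring
  cleared : ((a + b) * (u + v) - (x + y) * (x + y)) * (u * v) ≡ (x * v - y * u) * (x * v - y * u)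
  cleared = begin
    ((a + b) * (u + v) - (x + y) * (x + y)) * (u * v)
      ≡⟨ expand a b x y u v ⟩
    a * u * (u * v + v * v) + b * v * (u * u + u * v) - (x + y) * (x + y) * (u * v)
      ≡⟨ cong₂ (λ au bv → au * (u * v + v * v) + bv * (u * u + u * v) - (x + y) * (x + y) * (u * v))
               (÷?-inverse (x * x) 0<u) (÷?-inverse (y * y) 0<v) ⟩
    x * x * (u * v + v * v) + y * y * (u * u + u * v) - (x + y) * (x + y) * (u * v)
      ≡⟨ complete-square x y u v ⟩
    (x * v - y * u) * (x * v - y * u) ∎
    where open ≡-Reasoning

sq÷?-upper : ∀ {M a n s} → 0ℚ ≤ M → 0ℚ < a → 0ℚ ≤ n → 0ℚ ≤ s → s ≤ M * n
           → ((s + M * a) * (s + M * a)) ÷? (n + a) ≤ (s * s) ÷? n + M * M * a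
sq÷?-upper {M} {a} {n} {s} 0≤M 0<a 0≤n 0≤s s≤Mn with 0≤p⇒0<p⊎p≡0 0≤n
... | inj₁ 0<n = begin
  ((s + M * a) * (s + M * a)) ÷? (n + a)    ≤⟨ sedrakyan s (M * a) 0<n 0<a ⟩
  (s * s) ÷? n + ((M * a) * (M * a)) ÷? a   ≡⟨ cong (_+_ ((s * s) ÷? n)) (trans (cong (_÷? a) (square-scale M a)) ([r*q]÷?q≡r (M * M * a) 0<a)) ⟩
  (s * s) ÷? n + M * M * a                  ∎
  where
  open ≤-Reasoning
  square-scale : ∀ M a → (M * a) * (M * a) ≡ M * M * a * a
  square-scale = solve-∀ ℚ-ring
... | inj₂ refl with ℚₚ.≤-antisym (≤-trans s≤Mn (≤-reflexive (ℚₚ.*-zeroʳ M))) 0≤s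
...   | refl = begin
  ((0ℚ + M * a) * (0ℚ + M * a)) ÷? (0ℚ + a) ≡⟨ cong₂ _÷?_ (square-scale M a) (ℚₚ.+-identityˡ a) ⟩
  (M * M * a * a) ÷? a                      ≡⟨ [r*q]÷?q≡r (M * M * a) 0<a ⟩
  M * M * a                                 ≡⟨ sym (ℚₚ.+-identityˡ (M * M * a)) ⟩
  0ℚ + M * M * a                            ∎
  where
  open ≤-Reasoning
  square-scale : ∀ M a → (0ℚ + M * a) * (0ℚ + M * a) ≡ M * M * a * a
  square-scale = solve-∀ ℚ-ring

sq÷?-lower : ∀ {M b n s} → 0ℚ ≤ M → 0ℚ < b → 0ℚ ≤ n → 0ℚ ≤ s → s ≤ M * n
           → (s * s) ÷? n ≤ (s * s) ÷? (n + b) + M * M * b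
sq÷?-lower {M} {b} {n} {s} 0≤M 0<b 0≤n 0≤s s≤Mn with 0≤p⇒0<p⊎p≡0 0≤n
... | inj₁ 0<n = ≤-by-scaled-difference (b * ((M * n - s) * (M * n + s)) + M * M * b * b * n)
  (0<p*q 0<n 0<n+b) cleared
  (0≤p+q (0≤p*q 0≤b (0≤p*q (p≤q⇒0≤q-p s≤Mn) (0≤p+q (0≤p*q 0≤M 0≤n) 0≤s)))
         (0≤p*q (0≤p*q (0≤p*q (0≤p*q 0≤M 0≤M) 0≤b) 0≤b) 0≤n))
  where
  0≤b = <⇒≤ 0<b
  0<n+b = 0<p+q 0≤n 0<b
  y = (s * s) ÷? n
  z = (s * s) ÷? (n + b)
  expand : ∀ z y M b n → (z + M * M * b - y) * (n * (n + b))
         ≡ z * (n + b) * n + M * M * b * (n * (n + b)) - y * n * (n + b)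
  expand = solve-∀ ℚ-ring
  factor : ∀ s M b n → s * s * n + M * M * b * (n * (n + b)) - s * s * (n + b)
         ≡ b * ((M * n - s) * (M * n + s)) + M * M * b * b * n
  factor = solve-∀ ℚ-ring
  cleared : (z + M * M * b - y) * (n * (n + b)) ≡ b * ((M * n - s) * (M * n + s)) + M * M * b * b * n
  cleared = begin
    (z + M * M * b - y) * (n * (n + b))
      ≡⟨ expand z y M b n ⟩
    z * (n + b) * n + M * M * b * (n * (n + b)) - y * n * (n + b)
      ≡⟨ cong₂ (λ z′ y′ → z′ * n + M * M * b * (n * (n + b)) - y′ * (n + b))
               (÷?-inverse (s * s) 0<n+b) (÷?-inverse (s * s) 0<n) ⟩
    s * s * n + M * M * b * (n * (n + b)) - s * s * (n + b)
      ≡⟨ factor s M b n ⟩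
    b * ((M * n - s) * (M * n + s)) + M * M * b * b * n ∎
    where open ≡-Reasoning
... | inj₂ refl = 0≤p+q (÷?-nonNeg (0≤p*p s) (0<p+q ≤-refl 0<b)) (0≤p*q (0≤p*q 0≤M 0≤M) (<⇒≤ 0<b))

record MomentBounds (M n s q : ℚ) : Set where
  field
    0≤n     : 0ℚ ≤ n
    0≤s     : 0ℚ ≤ s
    s≤M*n   : s ≤ M * n
    0≤q     : 0ℚ ≤ q
    q≤M*M*n : q ≤ M * M * n

moments-zero : ∀ {M} → MomentBounds M 0ℚ 0ℚ 0ℚ
moments-zero {M} = record
  { 0≤n     = ≤-refl
  ; 0≤s     = ≤-refl
  ; s≤M*n   = ≤-reflexive (sym (ℚₚ.*-zeroʳ M))
  ; 0≤q     = ≤-refl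
  ; q≤M*M*n = ≤-reflexive (sym (ℚₚ.*-zeroʳ (M * M)))
  }

moments-point : ∀ {M y} → 0ℚ ≤ y → y ≤ M → MomentBounds M 1ℚ y (y * y)
moments-point {M} {y} 0≤y y≤M = record
  { 0≤n     = ℚₚ.nonNegative⁻¹ 1ℚ
  ; 0≤s     = 0≤y
  ; s≤M*n   = subst (y ≤_) (sym (ℚₚ.*-identityʳ M)) y≤M
  ; 0≤q     = 0≤p*q 0≤y 0≤y
  ; q≤M*M*n = subst (y * y ≤_) (sym (ℚₚ.*-identityʳ (M * M))) (p*p≤q*q 0≤y y≤M)
  }

moments-+ : ∀ {M n s q n′ s′ q′} → MomentBounds M n s q → MomentBounds M n′ s′ q′
          → MomentBounds M (n + n′) (s + s′) (q + q′)
moments-+ {M} {n} {s} {q} {n′} {s′} {q′} b b′ = record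
  { 0≤n     = 0≤p+q (0≤n b) (0≤n b′)
  ; 0≤s     = 0≤p+q (0≤s b) (0≤s b′)
  ; s≤M*n   = ≤-trans (+-mono-≤ (s≤M*n b) (s≤M*n b′)) (≤-reflexive (sym (ℚₚ.*-distribˡ-+ M n n′)))
  ; 0≤q     = 0≤p+q (0≤q b) (0≤q b′)
  ; q≤M*M*n = ≤-trans (+-mono-≤ (q≤M*M*n b) (q≤M*M*n b′)) (≤-reflexive (sym (ℚₚ.*-distribˡ-+ (M * M) n n′)))
  }
  where open MomentBounds

moments-empty : ∀ {M n s q} → MomentBounds M n s q → n ≤ 0ℚ → n ≡ 0ℚ × s ≡ 0ℚ × q ≡ 0ℚ
moments-empty {M} {n} b n≤0 = n≡0 , squeeze {M} (0≤s b) (s≤M*n b) , squeeze {M * M} (0≤q b) (q≤M*M*n b)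
  where
  open MomentBounds
  n≡0 = ℚₚ.≤-antisym n≤0 (0≤n b)
  squeeze : ∀ {c t} → 0ℚ ≤ t → t ≤ c * n → t ≡ 0ℚ
  squeeze {c} 0≤t t≤cn = ℚₚ.≤-antisym (≤-trans t≤cn (≤-reflexive (trans (cong (c *_) n≡0) (ℚₚ.*-zeroʳ c)))) 0≤t

SSEof : (n s q : ℚ) → ℚ
SSEof n s q = if n ≤ᵇ 0ℚ then 0ℚ else (q - (s * s) ÷? n)

-- Since s² ÷? 0 = 0 and n = 0 forces s = q = 0, the case split in SSEof is redundant.
SSEof-closed : ∀ {M n s q} → MomentBounds M n s q → SSEof n s q ≡ q - (s * s) ÷? n
SSEof-closed {n = n} b with n ≤ᵇ 0ℚ in n≤ᵇ0
... | false = refl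
... | true with moments-empty b (ℚₚ.≤ᵇ⇒≤ (subst T (sym n≤ᵇ0) _))
...   | refl , refl , refl = refl

SSEhat-error : ∀ {M a n s q n̂ ŝ q̂} → 0ℚ ≤ M → 0ℚ < a → MomentBounds M n s q
             → n ≤ n̂ → n̂ ≤ n + a → s ≤ ŝ → ŝ ≤ s + M * a → q ≤ q̂ → q̂ ≤ q + M * M * a
             → ∣ SSEhat a n̂ ŝ q̂ - SSEof n s q ∣ ≤ ⟦ 3 ⟧ * (M * M * a)
SSEhat-error {M} {a} {n} {s} {q} {n̂} {ŝ} {q̂} 0≤M 0<a bounds n≤n̂ n̂≤n+a s≤ŝ ŝ≤s+Ma q≤q̂ q̂≤q+MMa
  rewrite SSEof-closed bounds with n̂ ≤ᵇ 0ℚ in n̂≤ᵇ0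
... | false = -p≤q⇒p≤q⇒∣p∣≤q
  (≤-by-difference ((q̂ - q) + (y + E - x) + (E + E)) (lower-identity q q̂ x y E)
    (0≤p+q (0≤p+q (p≤q⇒0≤q-p q≤q̂) (p≤q⇒0≤q-p x≤y+E)) (0≤p+q 0≤E 0≤E)))
  (≤-by-difference ((q + E - q̂) + (x + M * M * (a + a) - y)) (upper-identity q q̂ x y M a)
    (0≤p+q (p≤q⇒0≤q-p q̂≤q+MMa) (p≤q⇒0≤q-p y≤x+2E)))
  where
  open MomentBounds bounds
  E = M * M * a
  0≤E = 0≤p*q (0≤p*q 0≤M 0≤M) (<⇒≤ 0<a)
  x = (ŝ * ŝ) ÷? (n̂ + a)
  y = (s * s) ÷? n
  0<n̂+a = 0<p+q (≤-trans 0≤n n≤n̂) 0<a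
  x≤y+E : x ≤ y + E
  x≤y+E = ≤-trans
    (÷?-mono-≤ (0≤p*p ŝ) (p*p≤q*q (≤-trans 0≤s s≤ŝ) ŝ≤s+Ma) (0<p+q 0≤n 0<a) (+-monoˡ-≤ a n≤n̂))
    (sq÷?-upper 0≤M 0<a 0≤n 0≤s s≤M*n)
  y≤x+2E : y ≤ x + M * M * (a + a)
  y≤x+2E = ≤-trans
    (sq÷?-lower 0≤M (0<p+q (<⇒≤ 0<a) 0<a) 0≤n 0≤s s≤M*n)
    (+-monoˡ-≤ (M * M * (a + a)) (÷?-mono-≤ (0≤p*p s) (p*p≤q*q 0≤s s≤ŝ) 0<n̂+a
      (≤-trans (+-monoˡ-≤ a n̂≤n+a) (≤-reflexive (ℚₚ.+-assoc n a a)))))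
  lower-identity : ∀ q q̂ x y E → ⟦ 3 ⟧ * E - - ((q̂ - x) - (q - y)) ≡ (q̂ - q) + (y + E - x) + (E + E)
  lower-identity = solve-∀ ℚ-ring
  upper-identity : ∀ q q̂ x y M a → ⟦ 3 ⟧ * (M * M * a) - ((q̂ - x) - (q - y))
                 ≡ (q + M * M * a - q̂) + (x + M * M * (a + a) - y)
  upper-identity = solve-∀ ℚ-ring
... | true with moments-empty bounds (≤-trans n≤n̂ (ℚₚ.≤ᵇ⇒≤ (subst T (sym n̂≤ᵇ0) _)))
...   | refl , refl , refl = 0≤p*q (0≤⟦n⟧ 3) (0≤p*q (0≤p*q 0≤M 0≤M) (<⇒≤ 0<a))

stream-moments : ∀ {M} st l r → All (λ p → proj₂ p ℕ.≤ M) st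
               → MomentBounds ⟦ M ⟧ (nR st l r) (sR st l r) (qR st l r)
stream-moments [] l r All.[] = moments-zero
stream-moments ((x , y) ∷ st) l r (y≤M All.∷ labels) with inI l r x
... | true  = moments-+ (moments-point (0≤⟦n⟧ y) (⟦⟧-mono-≤ y≤M)) (stream-moments st l r labels)
... | false = moments-+ moments-zero (stream-moments st l r labels)

SSE-estimate-error : ∀ {M β m n̂ ŝ q̂} st l r → All (λ p → proj₂ p ℕ.≤ M) st → 0ℚ < β * m
  → (nR st l r ≤ n̂) × (n̂ ≤ nR st l r + β * m)
  × (sR st l r ≤ ŝ) × (ŝ ≤ sR st l r + β * ⟦ M ⟧ * m)
  × (qR st l r ≤ q̂) × (q̂ ≤ qR st l r + β * ⟦ M ℕ.* M ⟧ * m)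
  → ∣ SSEhat (β * m) n̂ ŝ q̂ - SSE st l r ∣ ≤ ⟦ 3 ⟧ * (⟦ M ⟧ * ⟦ M ⟧ * (β * m))
SSE-estimate-error {M} {β} {m} {ŝ = ŝ} {q̂} st l r labels 0<βm (n≤n̂ , n̂≤ , s≤ŝ , ŝ≤ , q≤q̂ , q̂≤) =
  SSEhat-error (0≤⟦n⟧ M) 0<βm (stream-moments st l r labels) n≤n̂ n̂≤ s≤ŝ
    (subst (λ t → ŝ ≤ sR st l r + t) (regroup β ⟦ M ⟧ m) ŝ≤) q≤q̂
    (subst (λ t → q̂ ≤ qR st l r + t) (trans (cong (λ k → β * k * m) (⟦⟧-homo-* M M)) (regroup β (⟦ M ⟧ * ⟦ M ⟧) m)) q̂≤)
  where
  regroup : ∀ β k m → β * k * m ≡ k * (β * m)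
  regroup = solve-∀ ℚ-ring

InS⇒≤ : ∀ {N st sample j} → All (λ p → proj₁ p ℕ.≤ N) st → All (_∈ st) sample → InS N sample j → j ℕ.≤ N
InS⇒≤ _ _ (inj₁ refl) = ℕ.z≤n
InS⇒≤ _ _ (inj₂ (inj₁ refl)) = ℕₚ.≤-refl
InS⇒≤ xs≤N sampled (inj₂ (inj₂ (_ , p∈sample , _ , inj₁ refl))) =
  All.lookup xs≤N (All.lookup sampled p∈sample)
InS⇒≤ xs≤N sampled (inj₂ (inj₂ (_ , p∈sample , _ , inj₂ refl))) =
  ℕₚ.≤-trans (ℕₚ.m∸n≤m _ 1) (All.lookup xs≤N (All.lookup sampled p∈sample))

error-budget : ∀ {β m} M → 0ℚ ≤ β → 0ℚ ≤ m
  → ⟦ 3 ⟧ * (⟦ M ⟧ * ⟦ M ⟧ * (β * m)) + ⟦ 3 ⟧ * (⟦ M ⟧ * ⟦ M ⟧ * (β * m))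
    ≤ β * ⟦ 32 ℕ.* M ℕ.* M ⟧ * (+ 1 / 4) * m
error-budget {β} {m} M 0≤β 0≤m = begin
  ⟦ 3 ⟧ * (M′ * M′ * (β * m)) + ⟦ 3 ⟧ * (M′ * M′ * (β * m))
    ≤⟨ ≤-by-difference (⟦ 2 ⟧ * (M′ * M′ * (β * m))) (slack M′ β m)
         (0≤p*q (0≤⟦n⟧ 2) (0≤p*q (0≤p*q (0≤⟦n⟧ M) (0≤⟦n⟧ M)) (0≤p*q 0≤β 0≤m))) ⟩
  β * (⟦ 32 ⟧ * M′ * M′) * (+ 1 / 4) * m
    ≡⟨ cong (λ k → β * k * (+ 1 / 4) * m) (sym 32*M*M) ⟩
  β * ⟦ 32 ℕ.* M ℕ.* M ⟧ * (+ 1 / 4) * m ∎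
  where
  open ≤-Reasoning
  M′ = ⟦ M ⟧
  32*M*M : ⟦ 32 ℕ.* M ℕ.* M ⟧ ≡ ⟦ 32 ⟧ * M′ * M′
  32*M*M = trans (⟦⟧-homo-* (32 ℕ.* M) M) (cong (_* M′) (⟦⟧-homo-* 32 M))
  slack : ∀ M β m → β * (⟦ 32 ⟧ * M * M) * (+ 1 / 4) * m - (⟦ 3 ⟧ * (M * M * (β * m)) + ⟦ 3 ⟧ * (M * M * (β * m)))
        ≡ ⟦ 2 ⟧ * (M * M * (β * m))
  slack = solve-∀ ℚ-ring

lemma4 : (N M : ℕ) → 1 ℕ.≤ M → (st : Stream) → 1 ℕ.≤ length st
       → All (λ p → (1 ℕ.≤ Data.Product.proj₁ p) × (Data.Product.proj₁ p ℕ.≤ N) × (Data.Product.proj₂ p ℕ.≤ M)) st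
       → (sample : List (ℕ × ℕ)) → All (λ p → p ∈ st) sample
       → (ε : ℚ) → 0ℚ < ε → ε < 1ℚ
       → (nh sh qh : ℕ → ℕ → ℚ)
       → (∀ l r → 1 ℕ.≤ l → l ℕ.≤ suc r → r ℕ.≤ N
            → (nR st l r ≤ nh l r)
            × (nh l r ≤ nR st l r + (ε ÷? ⟦ 32 ℕ.* M ℕ.* M ⟧) * ⟦ length st ⟧)
            × (sR st l r ≤ sh l r)
            × (sh l r ≤ sR st l r + (ε ÷? ⟦ 32 ℕ.* M ℕ.* M ⟧) * ⟦ M ⟧ * ⟦ length st ⟧)
            × (qR st l r ≤ qh l r)
            × (qh l r ≤ qR st l r + (ε ÷? ⟦ 32 ℕ.* M ℕ.* M ⟧) * ⟦ M ℕ.* M ⟧ * ⟦ length st ⟧))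
       → ∀ j → InS N sample j
       → ∣ Lhat st N (ε ÷? ⟦ 32 ℕ.* M ℕ.* M ⟧) nh sh qh j - L st N j ∣ ≤ ε * (+ 1 / 4)
lemma4 N M 1≤M st 1≤m valid sample sampled ε 0<ε _ nh sh qh estimates j j∈S =
  ∣p÷?r-q÷?r∣≤e 0<m (begin
    ∣ (Â₁ + Â₂) - (A₁ + A₂) ∣  ≤⟨ ∣[p+q]-[r+s]∣≤∣p-r∣+∣q-s∣ Â₁ Â₂ A₁ A₂ ⟩
    ∣ Â₁ - A₁ ∣ + ∣ Â₂ - A₂ ∣  ≤⟨ +-mono-≤ (interval-error 1 j (ℕ.s≤s ℕ.z≤n) (ℕ.s≤s ℕ.z≤n) j≤N)
                                         (interval-error (suc j) N (ℕ.s≤s ℕ.z≤n) (ℕ.s≤s j≤N) ℕₚ.≤-refl) ⟩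
    E + E                      ≤⟨ error-budget M (<⇒≤ 0<β) (<⇒≤ 0<m) ⟩
    β * K * (+ 1 / 4) * m      ≡⟨ cong (λ e → e * (+ 1 / 4) * m) (÷?-inverse ε 0<K) ⟩
    ε * (+ 1 / 4) * m          ∎)
  where
  open ≤-Reasoning
  K = ⟦ 32 ℕ.* M ℕ.* M ⟧
  β = ε ÷? K
  m = ⟦ length st ⟧
  E = ⟦ 3 ⟧ * (⟦ M ⟧ * ⟦ M ⟧ * (β * m))
  Â₁ = SSEhat (β * m) (nh 1 j) (sh 1 j) (qh 1 j)
  Â₂ = SSEhat (β * m) (nh (suc j) N) (sh (suc j) N) (qh (suc j) N)
  A₁ = SSE st 1 j
  A₂ = SSE st (suc j) N
  0<m = 0<⟦n⟧ 1≤m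
  0<K = 0<⟦n⟧ (ℕₚ.*-mono-≤ (ℕₚ.*-mono-≤ {1} {32} (ℕ.s≤s ℕ.z≤n) 1≤M) 1≤M)
  0<β = ÷?-pos 0<ε 0<K
  j≤N = InS⇒≤ (All.map (proj₁ ∘ proj₂) valid) sampled j∈S
  interval-error : ∀ l r → 1 ℕ.≤ l → l ℕ.≤ suc r → r ℕ.≤ N
    → ∣ SSEhat (β * m) (nh l r) (sh l r) (qh l r) - SSE st l r ∣ ≤ E
  interval-error l r 1≤l l≤r+1 r≤N = SSE-estimate-error {M} {β} {m} st l r
    (All.map (proj₂ ∘ proj₂) valid) (0<p*q 0<β 0<m) (estimates l r 1≤l l≤r+1 r≤N)
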